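{- Let $\Theta$ be a set, let $\mathcal{F}$ be a $\sigma$-field over $\Theta$ (its elements are called hypotheses), and let $\mathcal{L}:\mathcal{F}\to\{0,0.5,1\}$ be a logically consistent agnostic hypothesis test. Let $H_1,H_2\in\mathcal{F}$ be such that $\mathcal{L}(H_1)\neq 0.5$ and $\mathcal{L}(H_2)\neq 0.5$. Then $\mathcal{L}\big(\Theta-(H_1\cap H_2)\big)=0$ if and only if it is not the case that both $\mathcal{L}(H_1)=0$ and $\mathcal{L}(H_2)=0$.
   Context: An agnostic hypothesis test is a function $\mathcal{L}:\mathcal{F}\to\{0,0.5,1\}$; $H$ is accepted ($\square H$) if $\mathcal{L}(H)=0$, rejected ($\lnot\Diamond H$) if $\mathcal{L}(H)=1$, undecided ($\nabla H$) if $\mathcal{L}(H)=0.5$; $\Diamond H$ means $\mathcal{L}(H)<1$, $\lnot\square H$ means $\mathcal{L}(H)>0$, and $H$ is decided ($\Delta H$) if $\mathcal{L}(H)\neq 0.5$. Write $\widetilde{H}=\Theta-H$. The test is logically consistent if: (i) invertibility: for all $H$, $\mathcal{L}(H)=0 \iff \mathcal{L}(\widetilde H)=1$, and $\mathcal{L}(H)=0.5\iff\mathcal{L}(\widetilde H)=0.5$; (ii) monotonicity: if $H\subseteq H'$ then $\mathcal{L}(H)=0\Rightarrow\mathcal{L}(H')=0$ and $\mathcal{L}(H)<1\Rightarrow\mathcal{L}(H')<1$; (iii) strong union consonance: for every family $\{H_i\}_{i\in I}\subseteq\mathcal F$ with $\cup_i H_i\in\mathcal F$, if $\mathcal{L}(\cup_{i}H_i)<1$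 then $\mathcal{L}(H_i)<1$ for some $i\in I$; (iv) strong intersection consonance: for every such family with $\cap_i H_i\in\mathcal F$, if $\mathcal{L}(\cap_i H_i)>0$ then $\mathcal{L}(H_i)>0$ for some $i\in I$; and (v) $\mathcal{L}(\Theta)=0$. -}

module Defs where

open import Data.Nat using (ℕ)
open import Data.Product using (Σ; ∃; _×_; _,_)
open import Relation.Nullary using (¬_)
open import Relation.Binary.PropositionalEquality using (_≡_; _≢_)
open import Data.Unit using (⊤)

Subset : Set → Set₁
Subset Θ = Θ → Set

module _ {Θ : Set} where

  whole : Subset Θ
  whole = λ _ → ⊤

  compl : Subset Θ → Subset Θ
  compl H = λ θ → ¬ H θ

  _∩_ : Subset Θ → Subset Θ → Subset Θ
  (A ∩ B) θ = A θ × B θ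

  _⊆_ : Subset Θ → Subset Θ → Set
  A ⊆ B = ∀ θ → A θ → B θ

  ⋃ : {I : Set} → (I → Subset Θ) → Subset Θ
  ⋃ {I} H θ = Σ I (λ i → H i θ)

  ⋂ : {I : Set} → (I → Subset Θ) → Subset Θ
  ⋂ {I} H θ = (i : I) → H i θ

-- Closure under countable and binary intersections is
-- classically a consequence of the other axioms (De Morgan); it is included
-- explicitly because it is not constructively derivable for predicate-valued
-- subsets (complements are only involutive up to ¬¬).
record SigmaField (Θ : Set) : Set₁ where
  field
    mem        : Subset Θ → Set
    whole∈     : mem whole
    compl∈     : ∀ {H} → mem H → mem (compl H)
    ⋃∈         : (H : ℕ → Subset Θ) → (∀ n → mem (H n)) → mem (⋃ H)
    ⋂∈         : (H : ℕ → Subset Θ) → (∀ n → mem (H n)) → mem (⋂ H)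
    ∩∈         : ∀ {A B} → mem A → mem B → mem (A ∩ B)

data Val : Set where
  v0 v½ v1 : Val

module _ {Θ : Set} (𝓕 : SigmaField Θ) where
  open SigmaField 𝓕

  Test : Set₁
  Test = (H : Subset Θ) → mem H → Val

  record LogicallyConsistent (L : Test) : Set₁ where
    field
      invert-0 : ∀ H (h : mem H) → (L H h ≡ v0 → L (compl H) (compl∈ h) ≡ v1)
                                  × (L (compl H) (compl∈ h) ≡ v1 → L H h ≡ v0)
      invert-½ : ∀ H (h : mem H) → (L H h ≡ v½ → L (compl H) (compl∈ h) ≡ v½)
                                  × (L (compl H) (compl∈ h) ≡ v½ → L H h ≡ v½)
      mono-0   : ∀ H H' (h : mem H) (h' : mem H') → H ⊆ H' → L H h ≡ v0 → L H' h' ≡ v0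
      mono-<1  : ∀ H H' (h : mem H) (h' : mem H') → H ⊆ H' → L H h ≢ v1 → L H' h' ≢ v1
      union-cons : (I : Set) (H : I → Subset Θ) (hs : ∀ i → mem (H i)) (hu : mem (⋃ H))
                   → L (⋃ H) hu ≢ v1 → ∃ λ i → L (H i) (hs i) ≢ v1
      inter-cons : (I : Set) (H : I → Subset Θ) (hs : ∀ i → mem (H i)) (hi : mem (⋂ H))
                   → L (⋂ H) hi ≢ v0 → ∃ λ i → L (H i) (hs i) ≢ v0
      whole-0  : L whole whole∈ ≡ v0

-- Accepting both H₁ and H₂ forces accepting H₁ ∩ H₂ (intersection consonance plus
-- monotonicity), hence rejecting its complement by invertibility. Conversely, if one
-- of the decided hypotheses is not accepted it is rejected, so its complement is
-- accepted, and monotonicity transfers acceptance to the larger set Θ - (H₁ ∩ H₂).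
module Submission where

open import Defs
open import Data.Product using (_×_; _,_; proj₁; proj₂)
open import Data.Nat using (ℕ; zero; suc)
open import Data.Empty using (⊥-elim)
open import Relation.Nullary using (¬_)
open import Relation.Binary.PropositionalEquality using (_≡_; _≢_; refl; sym; trans)
open import Function.Bundles using (_⇔_; mk⇔)

≡v0-stable : ∀ {v} → ¬ ¬ v ≡ v0 → v ≡ v0
≡v0-stable {v0} _   = refl
≡v0-stable {v½} ¬¬p = ⊥-elim (¬¬p λ ())
≡v0-stable {v1} ¬¬p = ⊥-elim (¬¬p λ ())

module _ {Θ : Set} {A B : Subset Θ} where

  pair : ℕ → Subset Θ
  pair zero    = A
  pair (suc _) = B

  ⋂-pair⊆∩ : ⋂ pair ⊆ (A ∩ B)
  ⋂-pair⊆∩ θ p = p zero , p 1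

module _ {Θ : Set} (𝓕 : SigmaField Θ) (L : Test 𝓕) (lc : LogicallyConsistent 𝓕 L) where
  open SigmaField 𝓕
  open LogicallyConsistent lc

  rejected⇒compl-accepted : ∀ H (h : mem H) → L H h ≡ v1 → L (compl H) (compl∈ h) ≡ v0
  rejected⇒compl-accepted H h e with L (compl H) (compl∈ h) in e'
  ... | v0 = refl
  ... | v½ with trans (sym e) (proj₂ (invert-½ H h) e')
  ...   | ()
  rejected⇒compl-accepted H h e | v1 with trans (sym e) (proj₂ (invert-0 H h) e')
  ...   | ()

  ⋂-accepted : (I : Set) (H : I → Subset Θ) (hs : ∀ i → mem (H i)) (hi : mem (⋂ H))
             → (∀ i → L (H i) (hs i) ≡ v0) → L (⋂ H) hi ≡ v0
  ⋂-accepted I H hs hi all0 = ≡v0-stable λ ≢0 →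
    let (i , Hi≢0) = inter-cons I H hs hi ≢0 in Hi≢0 (all0 i)

  ∩-accepted : ∀ {A B} (a : mem A) (b : mem B) → L A a ≡ v0 → L B b ≡ v0
             → L (A ∩ B) (∩∈ a b) ≡ v0
  ∩-accepted {A} {B} a b eA eB =
    mono-0 _ _ hi (∩∈ a b) ⋂-pair⊆∩ (⋂-accepted ℕ pair hs hi accepted)
    where
    hs : ∀ n → mem (pair {A = A} {B} n)
    hs zero    = a
    hs (suc _) = b
    hi : mem (⋂ (pair {A = A} {B}))
    hi = ⋂∈ pair hs
    accepted : ∀ n → L (pair n) (hs n) ≡ v0
    accepted zero    = eA
    accepted (suc _) = eB

lemma1 : {Θ : Set} (𝓕 : SigmaField Θ) (L : Test 𝓕) → LogicallyConsistent 𝓕 L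
       → (H₁ H₂ : Subset Θ) (h₁ : SigmaField.mem 𝓕 H₁) (h₂ : SigmaField.mem 𝓕 H₂)
       → L H₁ h₁ ≢ v½ → L H₂ h₂ ≢ v½
       → (L (compl (H₁ ∩ H₂)) (SigmaField.compl∈ 𝓕 (SigmaField.∩∈ 𝓕 h₁ h₂)) ≡ v0)
         ⇔ (¬ (L H₁ h₁ ≡ v0 × L H₂ h₂ ≡ v0))
lemma1 𝓕 L lc H₁ H₂ h₁ h₂ d₁ d₂ = mk⇔ not-both-accepted compl-accepted
  where
  open SigmaField 𝓕
  open LogicallyConsistent lc

  not-both-accepted : L (compl (H₁ ∩ H₂)) (compl∈ (∩∈ h₁ h₂)) ≡ v0
                    → ¬ (L H₁ h₁ ≡ v0 × L H₂ h₂ ≡ v0)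
  not-both-accepted e (e₁ , e₂)
    with trans (sym e) (proj₁ (invert-0 _ _) (∩-accepted 𝓕 L lc h₁ h₂ e₁ e₂))
  ... | ()

  compl-accepted : ¬ (L H₁ h₁ ≡ v0 × L H₂ h₂ ≡ v0)
                 → L (compl (H₁ ∩ H₂)) (compl∈ (∩∈ h₁ h₂)) ≡ v0
  compl-accepted ¬both with L H₁ h₁ in e₁ | L H₂ h₂ in e₂
  ... | v½ | _  = ⊥-elim (d₁ refl)
  ... | _  | v½ = ⊥-elim (d₂ refl)
  ... | v0 | v0 = ⊥-elim (¬both (refl , refl))
  ... | v1 | _  = mono-0 _ _ _ _ (λ θ ¬a p → ¬a (proj₁ p))
                    (rejected⇒compl-accepted 𝓕 L lc H₁ h₁ e₁)
  ... | v0 | v1 = mono-0 _ _ _ _ (λ θ ¬b p → ¬b (proj₂ p))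
                    (rejected⇒compl-accepted 𝓕 L lc H₂ h₂ e₂)
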